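{- Consider PV systems whose sites have distinct identifiers. There is no deterministic exploration algorithm that, given neither the number of sites $n$ nor any information on (an upper bound on) the system period $p$, solves PVG-Exploration on every feasible homogeneous PV graph with distinct site ids. This impossibility holds even if the algorithm may depend on the number of carriers $k$ (i.e. the agent knows $k$) and the agent has unlimited memory.
   Context: A PV system consists of a finite set $S$ of $n$ sites and a set $C$ of $k\le n$ carriers. Each carrier $c$ has a unique identifier $id(c)$ and a route $\pi(c)=\langle x_0,\dots,x_{p(c)-1}\rangle$, a finite sequence of sites $x_i\in S$; $p(c)$ is the period of $c$, and $\pi(c)[j]$ denotes $x_{j \bmod p(c)}$. At each time $t=0,1,2,\dots$ carrier $c$ moves from $\pi(c)[t]$ to $\pi(c)[t+1]$. The PV graph $\vec G_R$ is the directed edge-labelled multigraph on $S$ with edges $\bigcup_c\{(x_i,x_{i+1},i):0\le i<p(c)\}$ (indices mod $p(c)$). The system period is $p=\max_c p(c)$; the system is homogeneous if all $p(c)$ are equal. An exploring agent is placed at time $0$ at a starting site $x\in\{\pi(c)[0]:c\in C\}$. If at time $t$ the agent is at site $y$, it observes the identifier of $y$ (sites have distinct ids) and the identifiers of the carriers $c$ with $\pi(c)[t]=y$, and either halts or chooses one such carrier $c$ and moves with it to $\pi(c)[t+1]$, arriving at time $t+1$ (one move). A concrete walk is a sequence of edges $(a_i,a_{i+1},i)$, $i=0,1,\dots$, where for each $i$ some carrier $c_i$ has $\pi(c_i)[i]=a_i$, $\pi(c_i)[i+1]=a_{i+1}$; it is a concrete cover if it visits every site. $\vec G_R$ is feasible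 if from every starting site there exists a finite concrete cover. An algorithm solves PVG-Exploration on $\vec G_R$ if, from every starting site, the agent visits all sites and halts after finitely many moves. -}

module Defs where

open import Data.Nat using (ℕ; zero; suc; _≤_; _<_; NonZero)
open import Data.Nat.DivMod using (_mod_)
open import Data.Nat.Properties using (≤-decTotalOrder)
open import Data.Fin using (Fin; _≟_)
open import Data.List using (List; []; _∷_; map; filter; allFin)
import Data.List.Sort as Sort
open import Data.Maybe using (Maybe; just; nothing)
open import Data.Product using (Σ; ∃; ∃-syntax; _×_; _,_)
open import Function.Definitions using (Injective)
open import Relation.Binary.PropositionalEquality using (_≡_)
open import Relation.Nullary using (yes; no)

open Sort ≤-decTotalOrder using (sort)

record PVSystem (k : ℕ) : Set where
  field
    n          : ℕ
    k≤n        : k ≤ n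
    siteId     : Fin n → ℕ
    siteId-inj : Injective _≡_ _≡_ siteId
    carrierId     : Fin k → ℕ
    carrierId-inj : Injective _≡_ _≡_ carrierId
    period     : Fin k → ℕ
    period-nz  : (c : Fin k) → NonZero (period c)
    route      : (c : Fin k) → Fin (period c) → Fin n

  pos : Fin k → ℕ → Fin n
  pos c t = route c ((t mod period c) {{period-nz c}})

open PVSystem public

Homogeneous : ∀ {k} → PVSystem k → Set
Homogeneous {k} S = ∀ (c c′ : Fin k) → period S c ≡ period S c′

IsStart : ∀ {k} (S : PVSystem k) → Fin (n S) → Set
IsStart {k} S x = ∃[ c ] pos S c 0 ≡ x

ConcreteCoverFrom : ∀ {k} (S : PVSystem k) → Fin (n S) → Set
ConcreteCoverFrom {k} S x =
  Σ ℕ λ m → Σ (ℕ → Fin (n S)) λ a →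
      (a 0 ≡ x)
    × (∀ i → i < m → ∃[ c ] (pos S c i ≡ a i × pos S c (suc i) ≡ a (suc i)))
    × (∀ s → ∃[ i ] (i ≤ m × a i ≡ s))

Feasible : ∀ {k} → PVSystem k → Set
Feasible S = ∀ x → IsStart S x → ConcreteCoverFrom S x

-- What the agent observes at a site at time t: the site id and the
-- (set of) ids of carriers currently there, as a sorted list.
Obs : Set
Obs = ℕ × List ℕ

data Decision : Set where
  halt : Decision
  move : ℕ → Decision          -- board the carrier with this identifier

-- A deterministic agent with unlimited memory: its decision is an
-- arbitrary function of the whole history of observations
-- (most recent observation first).
Algorithm : Set
Algorithm = List Obs → Decision

module _ {k : ℕ} (S : PVSystem k) where

  observe : ℕ → Fin (n S) → Obs
  observe t y =
    siteId S y , sort (map (carrierId S) (filter (λ c → pos S c t ≟ y) (allFin k)))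

  findCarrier : ℕ → ℕ → Fin (n S) → List (Fin k) → Maybe (Fin k)
  findCarrier i t y []       = nothing
  findCarrier i t y (c ∷ cs) with carrierId S c Data.Nat.≟ i | pos S c t ≟ y
  ... | yes _ | yes _ = just c
  ... | _     | _     = findCarrier i t y cs

  data State : Set where
    at     : Fin (n S) → List Obs → State
    halted : Fin (n S) → State
    failed : State                          -- chose a carrier not present

  run : Algorithm → Fin (n S) → ℕ → State
  run A x zero = at x (observe 0 x ∷ [])
  run A x (suc t) with run A x t
  ... | halted y = halted y
  ... | failed   = failed
  ... | at y h with A h
  ...   | halt   = halted y
  ...   | move i with findCarrier i t y (allFin k)
  ...     | nothing = failed
  ...     | just c  = at (pos S c (suc t)) (observe (suc t) (pos S c (suc t)) ∷ h)

  siteOf : State → Maybe (Fin (n S))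
  siteOf (at y _)   = just y
  siteOf (halted y) = just y
  siteOf failed     = nothing

  IsHalted : State → Set
  IsHalted s = ∃[ y ] s ≡ halted y

  Solves : Algorithm → Set
  Solves A = ∀ x → IsStart S x →
    Σ ℕ λ T → IsHalted (run A x T)
            × (∀ s → ∃[ t ] (t ≤ T × siteOf (run A x t) ≡ just s))

module Submission where

-- The agent only ever sees site identifiers and the identifiers of the
-- carriers at its current site.  Two PV systems that place every carrier at
-- sites with the same identifiers up to time T are therefore
-- indistinguishable to any deterministic agent up to time T
-- ('Indistinguishable.simulation').
--
-- Both witness systems are homogeneous "shared-route" systems, in which all
-- carriers follow one common route; such a system is feasible as soon as one
-- period of the route passes through every site.  For k carriers we take the
-- ring on k sites.  A correct algorithm A halts on it at some time T.  The
-- detour system on k + 1 sites follows the ring up to time T and only then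
-- visits a fresh site.  Up to time T the agent cannot tell the two systems
-- apart, so it halts at time T on the detour system too, having visited only
-- sites whose identifiers occur in the ring: it never reaches the fresh site.

open import Defs
open import Data.Nat using (ℕ; zero; suc; _+_; _∸_; _≤_; _<_; _≤′_; ≤′-refl; ≤′-step; _≤?_; z≤n; s≤s; s≤s⁻¹; NonZero)
open import Data.Nat.Properties
  using (≤-decTotalOrder; ≤-refl; ≤-trans; n≤1+n; m≤m+n; <-irrefl; ≤⇒≤′; ≰⇒>; <⇒≤; +-monoʳ-≤; m+n∸m≡n)
open import Data.Nat.DivMod using (_mod_; m<n⇒m%n≡m)
open import Data.Fin using (Fin; toℕ; fromℕ; inject₁; _≟_) renaming (zero to fzero)
open import Data.Fin.Properties using (toℕ-injective; toℕ-fromℕ<; toℕ-fromℕ; toℕ-inject₁; toℕ<n)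
open import Data.List using ([]; _∷_; map; allFin)
open import Data.List.Properties using (map-cong; filter-≐)
import Data.List.Sort as Sort
open import Data.Maybe using (just; nothing)
open import Data.Product using (Σ; ∃-syntax; _×_; _,_)
open import Data.Empty using (⊥; ⊥-elim)
open import Data.Unit using (⊤; tt)
open import Relation.Nullary using (¬_; yes; no)
open import Relation.Binary.PropositionalEquality

open Sort ≤-decTotalOrder using (sort)

halted-stays : ∀ {k} (S : PVSystem k) (A : Algorithm) (x : Fin (n S)) {t t′ : ℕ} {y : Fin (n S)} →
  run S A x t ≡ halted y → t ≤′ t′ → run S A x t′ ≡ halted y
halted-stays S A x stopped ≤′-refl = stopped
halted-stays S A x stopped (≤′-step t≤t′) rewrite halted-stays S A x stopped t≤t′ = refl

SameView : ∀ {k} (S₁ S₂ : PVSystem k) → ℕ → Set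
SameView S₁ S₂ t = ∀ c → siteId S₁ (pos S₁ c t) ≡ siteId S₂ (pos S₂ c t)

module Indistinguishable {k : ℕ} (S₁ S₂ : PVSystem k)
  (sameCarrierIds : ∀ c → carrierId S₁ c ≡ carrierId S₂ c) where

  Alike : State S₁ → State S₂ → Set
  Alike (at y₁ h₁) (at y₂ h₂)   = siteId S₁ y₁ ≡ siteId S₂ y₂ × h₁ ≡ h₂
  Alike (halted y₁) (halted y₂) = siteId S₁ y₁ ≡ siteId S₂ y₂
  Alike failed failed           = ⊤
  Alike _ _                     = ⊥

  -- Within one time step with the same view, an agent at sites with equal
  -- identifiers meets the same carriers, hence observes the same thing and
  -- boards the same carrier.
  module _ {t : ℕ} (view : SameView S₁ S₂ t) {y₁ : Fin (n S₁)} {y₂ : Fin (n S₂)}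
           (sameSite : siteId S₁ y₁ ≡ siteId S₂ y₂) where

    present⇒ : ∀ {c} → pos S₁ c t ≡ y₁ → pos S₂ c t ≡ y₂
    present⇒ {c} here = siteId-inj S₂ (trans (sym (view c)) (trans (cong (siteId S₁) here) sameSite))

    present⇐ : ∀ {c} → pos S₂ c t ≡ y₂ → pos S₁ c t ≡ y₁
    present⇐ {c} here = siteId-inj S₁ (trans (view c) (trans (cong (siteId S₂) here) (sym sameSite)))

    sameObservation : observe S₁ t y₁ ≡ observe S₂ t y₂
    sameObservation = cong₂ _,_ sameSite (cong sort (begin
      map (carrierId S₁) (present₁ (allFin k)) ≡⟨ map-cong sameCarrierIds _ ⟩
      map (carrierId S₂) (present₁ (allFin k)) ≡⟨ cong (map (carrierId S₂)) samePresent ⟩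
      map (carrierId S₂) (present₂ (allFin k)) ∎))
      where
      open ≡-Reasoning
      present₁ = Data.List.filter (λ c → pos S₁ c t ≟ y₁)
      present₂ = Data.List.filter (λ c → pos S₂ c t ≟ y₂)
      samePresent = filter-≐ (λ c → pos S₁ c t ≟ y₁) (λ c → pos S₂ c t ≟ y₂) (present⇒ , present⇐) (allFin k)

    sameBoarding : ∀ i cs → findCarrier S₁ i t y₁ cs ≡ findCarrier S₂ i t y₂ cs
    sameBoarding i [] = refl
    sameBoarding i (c ∷ cs)
      with carrierId S₁ c Data.Nat.≟ i | pos S₁ c t ≟ y₁ | carrierId S₂ c Data.Nat.≟ i | pos S₂ c t ≟ y₂
    ... | yes _  | yes _ | yes _   | yes _  = refl
    ... | yes id | _     | no id′  | _      = ⊥-elim (id′ (trans (sym (sameCarrierIds c)) id))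
    ... | no id  | _     | yes id′ | _      = ⊥-elim (id (trans (sameCarrierIds c) id′))
    ... | no _   | _     | no _    | _      = sameBoarding i cs
    ... | yes _  | yes p | yes _   | no p′  = ⊥-elim (p′ (present⇒ p))
    ... | yes _  | no p  | yes _   | yes p′ = ⊥-elim (p (present⇐ p′))
    ... | yes _  | no _  | yes _   | no _   = sameBoarding i cs

  simulation : (A : Algorithm) {x₁ : Fin (n S₁)} {x₂ : Fin (n S₂)} → siteId S₁ x₁ ≡ siteId S₂ x₂ →
    {T : ℕ} → (∀ t → t ≤ T → SameView S₁ S₂ t) →
    ∀ t → t ≤ T → Alike (run S₁ A x₁ t) (run S₂ A x₂ t)
  simulation A same views zero _ = same , cong (_∷ []) (sameObservation (views 0 z≤n) same)
  simulation A {x₁} {x₂} same views (suc t) t<T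
    with run S₁ A x₁ t | run S₂ A x₂ t | simulation A same views t (≤-trans (n≤1+n t) t<T)
  ... | at y₁ h | at y₂ h′ | (sameY , refl) with A h
  ...   | halt = sameY
  ...   | move i
          with findCarrier S₁ i t y₁ (allFin k) | findCarrier S₂ i t y₂ (allFin k)
             | sameBoarding (views t (≤-trans (n≤1+n t) t<T)) sameY i (allFin k)
  ...     | nothing | .nothing | refl = tt
  ...     | just c  | .(just c) | refl =
            let view′ = views (suc t) t<T in view′ c , cong (_∷ h) (sameObservation view′ (view′ c))
  simulation A same views (suc t) _ | halted _ | halted _ | sameY = sameY
  simulation A same views (suc t) _ | failed   | failed   | _     = tt
  simulation A same views (suc t) _ | at _ _   | halted _ | ()
  simulation A same views (suc t) _ | at _ _   | failed   | ()
  simulation A same views (suc t) _ | halted _ | at _ _   | ()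
  simulation A same views (suc t) _ | halted _ | failed   | ()
  simulation A same views (suc t) _ | failed   | at _ _   | ()
  simulation A same views (suc t) _ | failed   | halted _ | ()

  alike-site : ∀ {s₁ s₂} → Alike s₁ s₂ → ∀ {z} → siteOf S₂ s₂ ≡ just z → ∃[ y ] siteId S₁ y ≡ siteId S₂ z
  alike-site {at y₁ _}   {at _ _}   (same , _) refl = y₁ , same
  alike-site {halted y₁} {halted _} same       refl = y₁ , same
  alike-site {failed}    {failed}   _          ()

  alike-halted : ∀ {y₁} s₂ → Alike (halted y₁) s₂ → ∃[ y₂ ] s₂ ≡ halted y₂ × siteId S₁ y₁ ≡ siteId S₂ y₂
  alike-halted (halted y₂) same = y₂ , refl , same

  -- If the agent halts in S₁ by time T, then in S₂ it never visits a site
  -- whose identifier is absent from S₁: before T the runs are alike, and from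
  -- T on the agent in S₂ has halted as well.
  visits-known-ids : (A : Algorithm) {x₁ : Fin (n S₁)} {x₂ : Fin (n S₂)} → siteId S₁ x₁ ≡ siteId S₂ x₂ →
    {T : ℕ} → (∀ t → t ≤ T → SameView S₁ S₂ t) → {y : Fin (n S₁)} → run S₁ A x₁ T ≡ halted y →
    ∀ t z → siteOf S₂ (run S₂ A x₂ t) ≡ just z → ∃[ y′ ] siteId S₁ y′ ≡ siteId S₂ z
  visits-known-ids A same views {y = y} stopped t z visit with t ≤? _
  ... | yes t≤T = alike-site (simulation A same views t t≤T) visit
  ... | no t≰T
        with alike-halted _ (subst (λ s → Alike s _) stopped (simulation A same views _ ≤-refl))
  ...   | y₂ , stopped₂ , sameY =
          alike-site (subst (Alike (halted y)) (sym (halted-stays S₂ A _ stopped₂ T≤t)) sameY) visit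
    where T≤t = ≤⇒≤′ (<⇒≤ (≰⇒> t≰T))

toℕ-mod : ∀ {m N} .{{_ : NonZero N}} → m < N → toℕ (m mod N) ≡ m
toℕ-mod m<N = trans (toℕ-fromℕ< _) (m<n⇒m%n≡m m<N)

mod-toℕ : ∀ {N} .{{_ : NonZero N}} (s : Fin N) → toℕ s mod N ≡ s
mod-toℕ s = toℕ-injective (toℕ-mod (toℕ<n s))

sharedRoute : ∀ {k} (N : ℕ) → k ≤ N → (q : ℕ) → (ℕ → Fin N) → PVSystem k
sharedRoute N k≤N q f = record
  { n = N ; k≤n = k≤N ; siteId = toℕ ; siteId-inj = toℕ-injective
  ; carrierId = toℕ ; carrierId-inj = toℕ-injective
  ; period = λ _ → suc q ; period-nz = λ _ → _
  ; route = λ _ j → f (toℕ j) }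

module SharedRoute {k : ℕ} (N : ℕ) (k≤N : k ≤ N) (q : ℕ) (f : ℕ → Fin N) where

  homogeneous : Homogeneous (sharedRoute {k} N k≤N q f)
  homogeneous _ _ = refl

  pos-early : ∀ c {t} → t ≤ q → pos (sharedRoute {k} N k≤N q f) c t ≡ f t
  pos-early c t≤q = cong f (toℕ-mod (s≤s t≤q))

  -- riding any carrier for one period is a concrete cover if f hits every site
  feasible : (∀ s → ∃[ i ] i ≤ q × f i ≡ s) → Feasible (sharedRoute {k} N k≤N q f)
  feasible onto x (c , start) =
    q , pos S c , start , (λ _ _ → c , refl , refl) , visit
    where
    S = sharedRoute {k} N k≤N q f
    visit : ∀ s → ∃[ i ] i ≤ q × pos S c i ≡ s
    visit s with onto s
    ... | i , i≤q , fi≡s = i , i≤q , trans (pos-early c i≤q) fi≡s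

module Witnesses (k′ : ℕ) where
  K : ℕ
  K = suc k′

  ring : PVSystem K
  ring = sharedRoute K ≤-refl k′ (_mod K)

  module Ring = SharedRoute K ≤-refl k′ (_mod K)

  ring-feasible : Feasible ring
  ring-feasible = Ring.feasible (λ s → toℕ s , s≤s⁻¹ (toℕ<n s) , mod-toℕ s)

  ring-pos : ∀ c t → pos ring c t ≡ t mod K
  ring-pos c t = mod-toℕ (t mod K)

  -- the detour after T: the ring up to time T, then the sites 0, 1, …, K of
  -- the K + 1 sites, the last of which is fresh
  detourRoute : ℕ → ℕ → Fin (suc K)
  detourRoute T j with j ≤? T
  ... | yes _ = inject₁ (j mod K)
  ... | no _  = (j ∸ suc T) mod suc K

  detourRoute-early : ∀ T {j} → j ≤ T → detourRoute T j ≡ inject₁ (j mod K)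
  detourRoute-early T {j} j≤T with j ≤? T
  ... | yes _   = refl
  ... | no j≰T = ⊥-elim (j≰T j≤T)

  detourRoute-late : ∀ T d → detourRoute T (suc T + d) ≡ d mod suc K
  detourRoute-late T d with suc T + d ≤? T
  ... | yes late≤T = ⊥-elim (<-irrefl refl (≤-trans (m≤m+n (suc T) d) late≤T))
  ... | no _       = cong (_mod suc K) (m+n∸m≡n (suc T) d)

  detour : ℕ → PVSystem K
  detour T = sharedRoute (suc K) (n≤1+n K) (suc T + K) (detourRoute T)

  module Detour (T : ℕ) = SharedRoute (suc K) (n≤1+n K) (suc T + K) (detourRoute T)

  detour-feasible : ∀ T → Feasible (detour T)
  detour-feasible T = Detour.feasible T λ s →
    suc T + toℕ s , +-monoʳ-≤ (suc T) (s≤s⁻¹ (toℕ<n s)) , trans (detourRoute-late T (toℕ s)) (mod-toℕ s)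

  ring-detour-view : ∀ T t → t ≤ T → SameView ring (detour T) t
  ring-detour-view T t t≤T c = begin
    toℕ (pos ring c t)                    ≡⟨ cong toℕ (ring-pos c t) ⟩
    toℕ (t mod K)                         ≡⟨ toℕ-inject₁ (t mod K) ⟨
    toℕ (inject₁ (t mod K))               ≡⟨ cong toℕ (detourRoute-early T t≤T) ⟨
    toℕ (detourRoute T t)                 ≡⟨ cong toℕ (Detour.pos-early T c t≤q) ⟨
    toℕ (pos (detour T) c t)              ∎
    where
    open ≡-Reasoning
    t≤q = ≤-trans t≤T (≤-trans (n≤1+n T) (m≤m+n (suc T) K))

  fresh-site-unknown : ∀ T (y : Fin K) → siteId ring y ≢ siteId (detour T) (fromℕ K)
  fresh-site-unknown T y same = <-irrefl (trans same (toℕ-fromℕ K)) (toℕ<n y)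

theorem2 : (k : ℕ) → 1 ≤ k →
    ¬ Σ Algorithm (λ A → (S : PVSystem k) → Homogeneous S → Feasible S → Solves S A)
theorem2 (suc k′) _ (A , solves) =
  let -- A halts on the ring at some time T …
      T , (_ , halts) , _ =
        solves ring Ring.homogeneous ring-feasible (pos ring fzero 0) (fzero , refl)
      -- … and on the detour after T it reaches the fresh site at some time t,
      _ , _ , visitsAll =
        solves (detour T) (Detour.homogeneous T) (detour-feasible T) (pos (detour T) fzero 0) (fzero , refl)
      t , _ , visitsFresh = visitsAll (fromℕ K)
      -- but all sites it visits there carry identifiers of ring sites.
      y , same = Indistinguishable.visits-known-ids ring (detour T) (λ _ → refl) A
                   (ring-detour-view T 0 z≤n fzero) (ring-detour-view T) halts t (fromℕ K) visitsFresh
  in fresh-site-unknown T y same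
  where open Witnesses k′
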